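{- Let $(\mathcal{G},\omega)$ be a graph decomposition of a linear code $\mathcal{C}\subseteq\mathbb{F}^I$, and let $(T,\beta)$ be a vertex-cut tree of $\mathcal{G}$. For each $z\in V(T)$ of degree $\delta$, let $J_i=\omega^{ -1}\big(\beta(V(T_i^{(z)}))\setminus\beta(z)\big)$ for $i=1,\ldots,\delta$, let $m(z)=\dim(\mathcal{C})-\sum_{i=1}^{\delta}\dim(\mathcal{C}_{J_i})$, and let $\mu(\mathcal{C};\omega,\beta)=\max_{z\in V(T)}m(z)$. Then for every graphical realization $\Gamma\in\mathfrak{R}(\mathcal{C};\mathcal{G},\omega)$, $$\kappa(\Gamma)\ge\frac{\mu(\mathcal{C};\omega,\beta)}{\text{vc-width}(T,\beta)}.$$
   Context: $\mathbb{F}$ is a finite field, $I$ a finite index set, $\mathcal{C}\subseteq\mathbb{F}^I$ a subspace. For $J\subseteq I$, $\mathcal{C}_J=\{\mathbf{c}|_J:\mathbf{c}\in\mathcal{C},\ \mathbf{c}|_{I\setminus J}=\mathbf{0}\}$ with $\mathbf{c}|_J=(c_i)_{i\in J}$. Graphs are finite. A graph decomposition of $\mathcal{C}$ is a pair $(\mathcal{G},\omega)$, $\mathcal{G}=(V,E)$ connected, $\omega:I\to V$ any map. $E(v)$ is the set of edges incident with $v$. A graphical model is $(\mathcal{G},\omega,(\mathcal{S}_e)_{e\in E},(C_v)_{v\in V})$ with $\mathcal{S}_e$ finite-dimensional $\mathbb{F}$-spaces and $C_v\subseteq\mathbb{F}^{\omega^{ -1}(v)}\oplus\bigoplus_{e\in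 E(v)}\mathcal{S}_e$ subspaces; its full behavior $\mathfrak{B}$ is the set of $\mathbf{b}=((x_i)_{i\in I},(\mathbf{s}_e)_{e\in E})$ with $\mathbf{b}|_v:=((x_i)_{i\in\omega^{ -1}(v)},(\mathbf{s}_e)_{e\in E(v)})\in C_v$ for all $v$. It is essential if $\{\mathbf{b}|_v:\mathbf{b}\in\mathfrak{B}\}=C_v$ and $\{\mathbf{s}_e:\mathbf{b}\in\mathfrak{B}\}=\mathcal{S}_e$ for all $v,e$. $\mathfrak{R}(\mathcal{C};\mathcal{G},\omega)$ is the set of essential graphical models with this $(\mathcal{G},\omega)$ whose full behavior projects onto $I$ exactly as $\mathcal{C}$ (graphical realizations of $\mathcal{C}$ extending $(\mathcal{G},\omega)$). $\kappa(\Gamma)=\max_{v\in V}\dim(C_v)$. For $W\subseteq V$, $N(W)$ is the set of vertices adjacent to some vertex of $W$; $(V_0,\ldots,V_\delta)$ is a star partition of $V$ if the $V_i$ are pairwise disjoint with union $V$ and $N(V_i)\subseteq V_i\cup V_0$ for $i\ge1$. For $z$ of degree $\delta$ in a tree $T$, $T_1^{(z)},\ldots,T_\delta^{(z)}$ are the components of $T-z$; for $\beta:V(T)\to2^{V(\mathcal{G})}$, $\beta(X)=\bigcup_{x\in X}\beta(x)$. A vertex-cut tree of $\mathcal{G}$ is $(T,\beta)$, $T$ a tree, such that (VC1) $\beta(V(T))=V(\mathcal{G})$; (VC2) $\beta(x)\cap\beta(y)\subseteq\beta(z)$ whenever $z$ lies on the path from $x$ to $y$ in $T$; (VC3) for each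 $z$ of degree $\delta$, $(\beta(z),V_1,\ldots,V_\delta)$ with $V_i=\beta(V(T_i^{(z)}))\setminus\beta(z)$ is a star partition of $V(\mathcal{G})$. $\text{vc-width}(T,\beta)=\max_{z}|\beta(z)|$. -}

module Defs where

open import Level using (Level; 0ℓ) renaming (_⊔_ to _⊔ˡ_; suc to lsuc)
open import Algebra.Bundles using (CommutativeRing)
open import Data.Nat using (ℕ; zero; suc) renaming (_+_ to _+ℕ_; _⊔_ to _⊔ℕ_)
open import Data.Integer using (ℤ; +_; _-_) renaming (_⊔_ to _⊔ℤ_)
open import Data.Fin using (Fin; zero; suc; _≟_)
open import Data.Fin.Subset using (Subset; _∈_; _∉_; ∣_∣)
open import Data.Bool using (Bool; true; false; _∨_; T; if_then_else_)
open import Data.Product using (Σ; ∃; ∃-syntax; _×_; _,_; proj₁; proj₂)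
open import Data.Sum using (_⊎_; inj₁; inj₂)
open import Data.Empty using (⊥)
open import Data.List using (List; []; _∷_)
open import Data.List.Membership.Propositional using () renaming (_∈_ to _∈ˡ_)
open import Data.List.Relation.Unary.All using (All)
open import Data.List.Relation.Unary.Unique.Propositional using (Unique)
open import Relation.Nullary using (¬_; does)
open import Relation.Unary using (Pred)
open import Relation.Binary.PropositionalEquality using (_≡_; _≢_)

record FiniteField (c ℓ : Level) : Set (lsuc (c ⊔ˡ ℓ)) where
  field
    commRing : CommutativeRing c ℓ
  open CommutativeRing commRing public
  field
    0≉1       : ¬ (0# ≈ 1#)
    inverse   : ∀ x → ¬ (x ≈ 0#) → ∃[ y ] (x * y ≈ 1#)
    size      : ℕ
    enum      : Fin size → Carrier
    enum-surj : ∀ x → ∃[ k ] (enum k ≈ x)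

sumℕ : ∀ k → (Fin k → ℕ) → ℕ
sumℕ zero    f = 0
sumℕ (suc k) f = f zero +ℕ sumℕ k (λ i → f (suc i))

maxℕ : ∀ k → (Fin k → ℕ) → ℕ
maxℕ zero    f = 0
maxℕ (suc k) f = f zero ⊔ℕ maxℕ k (λ i → f (suc i))

-- maximum of an integer family (the value + 0 for an empty family,
-- which never occurs for a tree; all relevant values are ≥ 0 anyway)
maxℤ : ∀ k → (Fin k → ℤ) → ℤ
maxℤ zero          f = + 0
maxℤ (suc zero)    f = f zero
maxℤ (suc (suc k)) f = f zero ⊔ℤ maxℤ (suc k) (λ i → f (suc i))

module LinAlg {c ℓ : Level} (F : FiniteField c ℓ) where
  open FiniteField F using (Carrier; _≈_; _+_; _*_; 0#)

  Vect : ∀ {a} → Set a → Set (a ⊔ˡ c)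
  Vect A = A → Carrier

  _≋_ : ∀ {a} {A : Set a} → Vect A → Vect A → Set (a ⊔ˡ ℓ)
  x ≋ y = ∀ i → x i ≈ y i

  0v : ∀ {a} {A : Set a} → Vect A
  0v _ = 0#

  _+v_ : ∀ {a} {A : Set a} → Vect A → Vect A → Vect A
  (x +v y) i = x i + y i

  _·v_ : ∀ {a} {A : Set a} → Carrier → Vect A → Vect A
  (k ·v x) i = k * x i

  record IsSubspace {a p} {A : Set a} (P : Pred (Vect A) p) : Set (a ⊔ˡ c ⊔ˡ ℓ ⊔ˡ p) where
    field
      resp     : ∀ {x y} → x ≋ y → P x → P y
      has-0    : P 0v
      +-closed : ∀ {x y} → P x → P y → P (x +v y)
      ·-closed : ∀ k {x} → P x → P (k ·v x)

  ΣF : ∀ d → (Fin d → Carrier) → Carrier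
  ΣF zero    f = 0#
  ΣF (suc d) f = f zero + ΣF d (λ k → f (suc k))

  lincomb : ∀ {a} {A : Set a} {d} → (Fin d → Carrier) → (Fin d → Vect A) → Vect A
  lincomb {d = d} cs vs i = ΣF d (λ k → cs k * vs k i)

  LinIndep : ∀ {a} {A : Set a} {d} → (Fin d → Vect A) → Set (a ⊔ˡ c ⊔ˡ ℓ)
  LinIndep {d = d} vs = ∀ (cs : Fin d → Carrier) → lincomb cs vs ≋ 0v → ∀ k → cs k ≈ 0#

  IsBasis : ∀ {a p} {A : Set a} {d} → Pred (Vect A) p → (Fin d → Vect A) → Set (a ⊔ˡ c ⊔ˡ ℓ ⊔ˡ p)
  IsBasis {d = d} P vs =
    (∀ k → P (vs k)) × LinIndep vs × (∀ x → P x → ∃[ cs ] (x ≋ lincomb {d = d} cs vs))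

  HasDim : ∀ {a p} {A : Set a} → Pred (Vect A) p → ℕ → Set (a ⊔ˡ c ⊔ˡ ℓ ⊔ˡ p)
  HasDim {A = A} P d = Σ (Fin d → Vect A) (IsBasis P)

  -- the shortened code  C_J = { c|_J : c ∈ C, c|_{I∖J} = 0 },  a subspace of F^J
  Short : ∀ {n p} → Pred (Vect (Fin n)) p → (J : Subset n) →
          Pred (Vect (Σ (Fin n) (λ i → i ∈ J))) (c ⊔ˡ ℓ ⊔ˡ p)
  Short C J y = ∃[ x ] (C x × (∀ i → i ∉ J → x i ≈ 0#) × (∀ j → x (proj₁ j) ≈ y j))

record Graph : Set where
  field
    nV   : ℕ
    nE   : ℕ
    ends : Fin nE → Fin nV × Fin nV
open Graph public

module _ (G : Graph) where

  Joins : Fin (nE G) → Fin (nV G) → Fin (nV G) → Set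
  Joins e u v = ends G e ≡ (u , v) ⊎ ends G e ≡ (v , u)

  Adjacent : Fin (nV G) → Fin (nV G) → Set
  Adjacent u v = ∃[ e ] Joins e u v

  incB : Fin (nE G) → Fin (nV G) → Bool
  incB e v = does (proj₁ (ends G e) ≟ v) ∨ does (proj₂ (ends G e) ≟ v)

  IncEdge : Fin (nV G) → Set
  IncEdge v = Σ (Fin (nE G)) (λ e → T (incB e v))

  other : Fin (nE G) → Fin (nV G) → Fin (nV G)
  other e z = if does (proj₁ (ends G e) ≟ z) then proj₂ (ends G e) else proj₁ (ends G e)

  data Walk : Fin (nV G) → Fin (nV G) → Set where
    []   : ∀ {u} → Walk u u
    step : ∀ {u v w} (e : Fin (nE G)) → Joins e u v → Walk v w → Walk u w

  vertsW : ∀ {u w} → Walk u w → List (Fin (nV G))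
  vertsW {u} []           = u ∷ []
  vertsW {u} (step e j p) = u ∷ vertsW p

  edgesW : ∀ {u w} → Walk u w → List (Fin (nE G))
  edgesW []           = []
  edgesW (step e j p) = e ∷ edgesW p

  IsPath : ∀ {u w} → Walk u w → Set
  IsPath p = Unique (vertsW p)

  Connected : Set
  Connected = ∀ u v → Walk u v

  IsTree : Set
  IsTree = Connected ×
    (∀ e → ¬ Σ (Walk (proj₁ (ends G e)) (proj₂ (ends G e))) (λ p → All (_≢ e) (edgesW p)))

  N : Pred (Fin (nV G)) 0ℓ → Pred (Fin (nV G)) 0ℓ
  N W v = ∃[ u ] (W u × Adjacent u v)

  record IsStarPartition {K : Set} (V₀ : Pred (Fin (nV G)) 0ℓ)
                         (Vs : K → Pred (Fin (nV G)) 0ℓ) : Set where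
    field
      disj₀ : ∀ k v → V₀ v → Vs k v → ⊥
      disj  : ∀ k k′ v → k ≢ k′ → Vs k v → Vs k′ v → ⊥
      cover : ∀ v → V₀ v ⊎ ∃[ k ] Vs k v
      nbhd  : ∀ k v → N (Vs k) v → Vs k v ⊎ V₀ v

module _ (G T′ : Graph) (β : Fin (nV T′) → Subset (nV G)) where

  -- the component of T′ − z containing the other end of the edge e (incident with z);
  -- for a tree these are exactly the components T_i^{(z)}, one per edge at z
  Comp : Fin (nV T′) → Fin (nE T′) → Pred (Fin (nV T′)) 0ℓ
  Comp z e x = Σ (Walk T′ (other T′ e z) x) (λ p → All (_≢ z) (vertsW T′ p))

  Vcomp : Fin (nV T′) → Fin (nE T′) → Pred (Fin (nV G)) 0ℓ
  Vcomp z e v = v ∉ β z × ∃[ x ] (Comp z e x × v ∈ β x)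

  record IsVertexCutTree : Set where
    field
      tree : IsTree T′
      VC1  : ∀ v → ∃[ x ] (v ∈ β x)
      VC2  : ∀ x y z (p : Walk T′ x y) → IsPath T′ p → z ∈ˡ vertsW T′ p →
             ∀ v → v ∈ β x → v ∈ β y → v ∈ β z
      VC3  : ∀ z → IsStarPartition G (λ v → v ∈ β z)
                     (λ (k : IncEdge T′ z) → Vcomp z (proj₁ k))

  vcWidth : ℕ
  vcWidth = maxℕ (nV T′) (λ z → ∣ β z ∣)

module Models {c ℓ : Level} (F : FiniteField c ℓ) where
  open FiniteField F using (Carrier; _≈_; _+_; _*_; 0#)
  open LinAlg F

  module _ {n : ℕ} (G : Graph) (ω : Fin n → Fin (nV G)) (sdim : Fin (nE G) → ℕ) where

    -- coordinates of  F^{ω⁻¹(v)} ⊕ ⨁_{e ∈ E(v)} S_e ,  with S_e = F^{sdim e}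
    LocIdx : Fin (nV G) → Set
    LocIdx v = Σ (Fin n) (λ i → T (does (ω i ≟ v)))
             ⊎ Σ (IncEdge G v) (λ k → Fin (sdim (proj₁ k)))

    -- coordinates of a configuration ((x_i)_{i∈I}, (s_e)_{e∈E})
    GIdx : Set
    GIdx = Fin n ⊎ Σ (Fin (nE G)) (λ e → Fin (sdim e))

    loc : ∀ v → LocIdx v → GIdx
    loc v (inj₁ (i , _))       = inj₁ i
    loc v (inj₂ ((e , _) , k)) = inj₂ (e , k)

  record GraphicalModel (n : ℕ) (G : Graph) (ω : Fin n → Fin (nV G)) : Set (lsuc (c ⊔ˡ ℓ)) where
    field
      sdim   : Fin (nE G) → ℕ
      Cv     : (v : Fin (nV G)) → Pred (Vect (LocIdx G ω sdim v)) (c ⊔ˡ ℓ)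
      Cv-sub : ∀ v → IsSubspace (Cv v)

    Behavior : Pred (Vect (GIdx G ω sdim)) (c ⊔ˡ ℓ)
    Behavior b = ∀ v → Cv v (λ j → b (loc G ω sdim v j))

    IsEssential : Set (c ⊔ˡ ℓ)
    IsEssential =
      (∀ v x → Cv v x → ∃[ b ] (Behavior b × (λ j → b (loc G ω sdim v j)) ≋ x)) ×
      (∀ e (y : Vect (Fin (sdim e))) → ∃[ b ] (Behavior b × (λ k → b (inj₂ (e , k))) ≋ y))

    Realizes : Pred (Vect (Fin n)) (c ⊔ˡ ℓ) → Set (c ⊔ˡ ℓ)
    Realizes C = ∀ x →
      (C x → ∃[ b ] (Behavior b × (λ i → b (inj₁ i)) ≋ x)) ×
      (∃[ b ] (Behavior b × (λ i → b (inj₁ i)) ≋ x) → C x)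

  open GraphicalModel public

  InRealizations : ∀ {n} {G : Graph} {ω : Fin n → Fin (nV G)} →
                   Pred (Vect (Fin n)) (c ⊔ˡ ℓ) → GraphicalModel n G ω → Set (c ⊔ˡ ℓ)
  InRealizations C Γ = IsEssential Γ × Realizes Γ C

  -- κ(Γ) = max_v dim C_v, given the dimensions dimCv v = dim C_v
  κ : ∀ {nv} → (Fin nv → ℕ) → ℕ
  κ {nv} dimCv = maxℕ nv dimCv

  mval : (T′ : Graph) → ℕ → (Fin (nV T′) → Fin (nE T′) → ℕ) → Fin (nV T′) → ℤ
  mval T′ dimC dimJ z =
    + dimC - + sumℕ (nE T′) (λ e → if incB T′ e z then dimJ z e else 0)

  μ : (T′ : Graph) → ℕ → (Fin (nV T′) → Fin (nE T′) → ℕ) → ℤ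
  μ T′ dimC dimJ = maxℤ (nV T′) (mval T′ dimC dimJ)

module Submission where

-- Fix a vertex z of the vertex-cut tree.  By (VC3) the bag V₀ = β(z) and the branches
-- W_e = β(T_e) ∖ β(z) form a star partition of G.  Lift a basis of C to configurations
-- of the full behavior and record their coordinates at the vertices of V₀ as a matrix M
-- with Σ_{v ∈ V₀} dim C_v columns.  A combination whose coefficients lie in the left
-- kernel of M vanishes on V₀, so it splits into branch configurations, each again in
-- the full behavior; their symbols lie in the shortened codes C_{J_e}.  A rank bound
-- proved by Gaussian elimination then gives dim C ≤ Σ_{v ∈ V₀} dim C_v + Σ_e dim C_{J_e},
-- i.e. m(z) ≤ |β(z)| κ(Γ) ≤ κ(Γ) · vc-width, and the theorem takes the maximum over z.

open import Defs
open import Level using (_⊔_; 0ℓ)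
open import Data.Nat as ℕ using (ℕ; zero; suc; z≤n; s≤s) renaming (_+_ to _+ℕ_; _*_ to _*ℕ_; _≤_ to _≤ℕ_)
import Data.Nat.Properties as ℕP
open import Data.Integer as ℤ using (ℤ; +_) renaming (_≤_ to _≤ℤ_)
import Data.Integer.Properties as ℤP
open import Data.Fin using (Fin; zero; suc; punchIn; _↑ˡ_; _↑ʳ_) renaming (_≟_ to _≟ᶠ_)
import Data.Fin.Properties as FinP
open import Data.Fin.Subset using (Subset; ∣_∣; _∈_; _∉_)
open import Data.Vec using ([]; _∷_; lookup)
open import Data.Vec.Properties using ([]=⇒lookup)
open import Data.Vec.Functional using (Vector; _++_; insertAt)
open import Data.Vec.Functional.Properties using (lookup-++ˡ; lookup-++ʳ; insertAt-lookup; insertAt-punchIn)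
open import Data.Product using (Σ; ∃-syntax; _×_; _,_; proj₁; proj₂)
open import Data.Sum as Sum using (_⊎_; inj₁; inj₂)
open import Data.Bool.Properties using (T-∨)
open import Function.Bundles using (Equivalence)
open import Data.Bool using (Bool; true; false; if_then_else_; T)
open import Data.Empty using (⊥-elim)
open import Function using (_∘_)
open import Relation.Nullary using (¬_; Dec; yes; no; does)
open import Relation.Nullary.Negation using (¬¬-map)
open import Relation.Nullary.Decidable using (decidable-stable; ¬¬-excluded-middle; _⊎-dec_)
open import Relation.Binary.PropositionalEquality as ≡ using (_≡_; _≢_)
open import Relation.Unary using (Pred)
open import Data.Fin.Subset.Properties using (_∈?_)

≤-maxℕ : ∀ k (f : Fin k → ℕ) i → f i ≤ℕ maxℕ k f
≤-maxℕ (suc k) f zero    = ℕP.m≤m⊔n _ _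
≤-maxℕ (suc k) f (suc i) = ℕP.≤-trans (≤-maxℕ k (f ∘ suc) i) (ℕP.m≤n⊔m (f zero) _)

maxℤ-lub : ∀ k (f : Fin k → ℤ) B → + 0 ≤ℤ B → (∀ i → f i ≤ℤ B) → maxℤ k f ≤ℤ B
maxℤ-lub zero          f B 0≤B f≤B = 0≤B
maxℤ-lub (suc zero)    f B 0≤B f≤B = f≤B zero
maxℤ-lub (suc (suc k)) f B 0≤B f≤B = ℤP.⊔-lub (f≤B zero) (maxℤ-lub (suc k) (f ∘ suc) B 0≤B (f≤B ∘ suc))

selected : ∀ {k} → (Fin k → Bool) → (Fin k → ℕ) → Fin k → ℕ
selected act d i = if act i then d i else 0

sum-over-subset : ∀ k (p : Subset k) (d : Fin k → ℕ) bound → (∀ i → d i ≤ℕ bound) →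
                  sumℕ k (selected (lookup p) d) ≤ℕ ∣ p ∣ *ℕ bound
sum-over-subset zero    []          d bound d≤ = z≤n
sum-over-subset (suc k) (true ∷ p)  d bound d≤ =
  ℕP.+-mono-≤ (d≤ zero) (sum-over-subset k p (d ∘ suc) bound (d≤ ∘ suc))
sum-over-subset (suc k) (false ∷ p) d bound d≤ = sum-over-subset k p (d ∘ suc) bound (d≤ ∘ suc)

minus-≤ : ∀ D S₁ S₂ X → D ≤ℕ S₁ +ℕ S₂ → S₁ ≤ℕ X → + D ℤ.- + S₂ ≤ℤ + X
minus-≤ D S₁ S₂ X D≤S S₁≤X = begin
  + D ℤ.- + S₂         ≡⟨ ℤP.m-n≡m⊖n D S₂ ⟩
  D ℤ.⊖ S₂             ≤⟨ ℤP.⊖-monoˡ-≤ S₂ D≤S ⟩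
  (S₁ +ℕ S₂) ℤ.⊖ S₂    ≡⟨ ℤP.⊖-≥ (ℕP.m≤n+m S₂ S₁) ⟩
  + (S₁ +ℕ S₂ ℕ.∸ S₂)  ≡⟨ ≡.cong +_ (ℕP.m+n∸n≡m S₁ S₂) ⟩
  + S₁                 ≤⟨ ℤ.+≤+ S₁≤X ⟩
  + X                  ∎
  where open ℤP.≤-Reasoning

¬¬-∀-Fin : ∀ {p} k {P : Fin k → Set p} → (∀ i → ¬ ¬ P i) → ¬ ¬ (∀ i → P i)
¬¬-∀-Fin zero    ¬¬P ¬∀P = ¬∀P (λ ())
¬¬-∀-Fin (suc k) ¬¬P ¬∀P = ¬¬P zero λ P₀ →
  ¬¬-∀-Fin k (¬¬P ∘ suc) λ P₊ → ¬∀P λ { zero → P₀ ; (suc i) → P₊ i }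

¬¬-decidable-Fin : ∀ {p} k {P : Fin k → Set p} → ¬ ¬ (∀ i → Dec (P i))
¬¬-decidable-Fin k = ¬¬-∀-Fin k (λ _ → ¬¬-excluded-middle)

-- A family of vectors g i of lengths d i, where block i is present
-- only when act i holds, is laid out as one vector whose length
-- sumℕ k (selected act d) is the total size of the present blocks.  These collect
-- the local coordinates at the vertices of a bag, and the bases of the shortened
-- codes of the branches, into single families.

module _ {a} {A : Set a} where

  optional : (b : Bool) {d : ℕ} → (T b → Vector A d) → Vector A (if b then d else 0)
  optional true  g = g _
  optional false g ()

  concatᵇ : ∀ k (f : Fin k → ℕ) → ((i : Fin k) → Vector A (f i)) → Vector A (sumℕ k f)
  concatᵇ zero    f g ()
  concatᵇ (suc k) f g = g zero ++ concatᵇ k (f ∘ suc) (g ∘ suc)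

  blocks : ∀ {k} (act : Fin k → Bool) (d : Fin k → ℕ) →
           ((i : Fin k) → T (act i) → Vector A (d i)) → Vector A (sumℕ k (selected act d))
  blocks {k} act d g = concatᵇ k (selected act d) (λ i → optional (act i) (g i))

offset : ∀ k (f : Fin k → ℕ) (i : Fin k) → Fin (f i) → Fin (sumℕ k f)
offset (suc k) f zero    t = t ↑ˡ sumℕ k (f ∘ suc)
offset (suc k) f (suc i) t = f zero ↑ʳ offset k (f ∘ suc) i t

optional-pos : (b : Bool) {d : ℕ} → T b → Fin d → Fin (if b then d else 0)
optional-pos true _ t = t

blockPos : ∀ {k} (act : Fin k → Bool) (d : Fin k → ℕ) (i : Fin k) →
           T (act i) → Fin (d i) → Fin (sumℕ k (selected act d))
blockPos {k} act d i p t = offset k (selected act d) i (optional-pos (act i) p t)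

module _ {a} {A : Set a} where

  concatᵇ-offset : ∀ k f (g : (i : Fin k) → Vector A (f i)) i t → concatᵇ k f g (offset k f i t) ≡ g i t
  concatᵇ-offset (suc k) f g zero    t = lookup-++ˡ (g zero) _ t
  concatᵇ-offset (suc k) f g (suc i) t =
    ≡.trans (lookup-++ʳ (g zero) _ _) (concatᵇ-offset k (f ∘ suc) (g ∘ suc) i t)

  optional-optional-pos : (b : Bool) {d : ℕ} (g : T b → Vector A d) (p : T b) (t : Fin d) →
                          optional b g (optional-pos b p t) ≡ g p t
  optional-optional-pos true g p t = ≡.refl

  blocks-blockPos : ∀ {k} act d (g : (i : Fin k) → T (act i) → Vector A (d i)) i p t →
                    blocks act d g (blockPos act d i p t) ≡ g i p t
  blocks-blockPos {k} act d g i p t =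
    ≡.trans (concatᵇ-offset k (selected act d) (λ i → optional (act i) (g i)) i _)
            (optional-optional-pos (act i) (g i) p t)

module LinearAlgebra {c ℓ} (F : FiniteField c ℓ) where
  open FiniteField F hiding (zero)
  open LinAlg F
  open import Algebra.Properties.Semiring.Sum semiring
    using (sum; sum-cong-≋; sum-replicate-zero; sum-remove; ∑-distrib-+; ∑-comm; *-distribˡ-sum; *-distribʳ-sum)
  open import Algebra.Properties.Ring ring using (-‿distribˡ-*; -‿distribʳ-*)
  open import Relation.Binary.Reasoning.Setoid setoid

  ΣF≡sum : ∀ d (f : Fin d → Carrier) → ΣF d f ≡ sum f
  ΣF≡sum zero    f = ≡.refl
  ΣF≡sum (suc d) f = ≡.cong (_+_ (f zero)) (ΣF≡sum d (f ∘ suc))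

  lincomb≈sum : ∀ {a} {A : Set a} {d} (cs : Fin d → Carrier) (vs : Fin d → Vect A) i →
                lincomb cs vs i ≈ sum (λ k → cs k * vs k i)
  lincomb≈sum {d = d} cs vs i = reflexive (ΣF≡sum d _)

  lincomb-cong : ∀ {a b} {A : Set a} {B : Set b} {d} (cs : Fin d → Carrier) {vs : Fin d → Vect A} {ws : Fin d → Vect B} {x y} →
                 (∀ k → vs k x ≈ ws k y) → lincomb cs vs x ≈ lincomb cs ws y
  lincomb-cong {d = d} cs {vs} {ws} {x} {y} vs≈ws =
    trans (lincomb≈sum cs vs x) (trans (sum-cong-≋ {d} (λ k → *-congˡ (vs≈ws k))) (sym (lincomb≈sum cs ws y)))

  sum-zero : ∀ {d} {f : Fin d → Carrier} → (∀ k → f k ≈ 0#) → sum f ≈ 0#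
  sum-zero {d} f≈0 = trans (sum-cong-≋ f≈0) (sum-replicate-zero d)

  sum-single : ∀ {d} (f : Fin d → Carrier) k₀ → (∀ k → k ≢ k₀ → f k ≈ 0#) → sum f ≈ f k₀
  sum-single {suc d} f k₀ f≈0 = begin
    sum f                              ≈⟨ sum-remove f ⟩
    f k₀ + sum (f ∘ punchIn k₀)        ≈⟨ +-congˡ (sum-zero (λ k → f≈0 _ (FinP.punchInᵢ≢i k₀ k))) ⟩
    f k₀ + 0#                          ≈⟨ +-identityʳ _ ⟩
    f k₀                               ∎

  sum-++ : ∀ m {n} (f : Fin (m +ℕ n) → Carrier) →
           sum f ≈ sum (λ k → f (k ↑ˡ n)) + sum (λ k → f (m ↑ʳ k))
  sum-++ zero    f = sym (+-identityˡ _)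
  sum-++ (suc m) f = trans (+-congˡ (sum-++ m (f ∘ suc))) (sym (+-assoc _ _ _))

  sum-concatᵇ : ∀ k f (h : Fin (sumℕ k f) → Carrier) → sum h ≈ sum (λ i → sum (h ∘ offset k f i))
  sum-concatᵇ zero    f h = refl
  sum-concatᵇ (suc k) f h =
    trans (sum-++ (f zero) h) (+-congˡ (sum-concatᵇ k (f ∘ suc) (λ col → h (f zero ↑ʳ col))))

  when : (b : Bool) → (T b → Carrier) → Carrier
  when true  g = g _
  when false g = 0#

  when-zero : ∀ b (g : T b → Carrier) → (∀ p → g p ≈ 0#) → when b g ≈ 0#
  when-zero true  g g≈0 = g≈0 _
  when-zero false g g≈0 = refl

  when-true : ∀ b (g : T b → Carrier) (p : T b) → when b g ≈ g p
  when-true true g p = refl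

  when-cong : ∀ b {g h : T b → Carrier} → (∀ p → g p ≈ h p) → when b g ≈ when b h
  when-cong true  g≈h = g≈h _
  when-cong false g≈h = refl

  sum-optional : ∀ b {d} (h : Fin (if b then d else 0) → Carrier) →
                 sum h ≈ when b (λ p → sum (h ∘ optional-pos b p))
  sum-optional true  h = refl
  sum-optional false h = refl

  sum-blocks : ∀ {k} act d (h : Fin (sumℕ k (selected act d)) → Carrier) →
               sum h ≈ sum (λ i → when (act i) (λ p → sum (λ t → h (blockPos act d i p t))))
  sum-blocks {k} act d h =
    trans (sum-concatᵇ k (selected act d) h) (sum-cong-≋ (λ i → sum-optional (act i) _))

  sum-assoc : ∀ {D K : ℕ} (α : Fin D → Carrier) (R : Fin D → Fin K → Carrier) (w : Fin K → Carrier) →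
              sum (λ j → α j * sum (λ t → R j t * w t)) ≈ sum (λ t → sum (λ j → α j * R j t) * w t)
  sum-assoc {D} {K} α R w = begin
    sum (λ j → α j * sum (λ t → R j t * w t))     ≈⟨ sum-cong-≋ {D} (λ j → *-distribˡ-sum {K} (α j) _) ⟩
    sum (λ j → sum (λ t → α j * (R j t * w t)))   ≈⟨ ∑-comm (λ j t → α j * (R j t * w t)) ⟩
    sum (λ t → sum (λ j → α j * (R j t * w t)))   ≈⟨ sum-cong-≋ {K} (λ t → sum-cong-≋ {D} (λ j → sym (*-assoc _ _ _))) ⟩
    sum (λ t → sum (λ j → (α j * R j t) * w t))   ≈⟨ sum-cong-≋ {K} (λ t → sym (*-distribʳ-sum (w t) (λ j → α j * R j t))) ⟩
    sum (λ t → sum (λ j → α j * R j t) * w t)     ∎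

  LeftKernel : ∀ {D K} → (Fin D → Fin K → Carrier) → (Fin D → Carrier) → Set ℓ
  LeftKernel {D} {K} R α = ∀ (t : Fin K) → sum {D} (λ j → α j * R j t) ≈ 0#

  left-kernel-kills : ∀ {D K} (R : Fin D → Fin K → Carrier) (w : Fin K → Carrier) (X : Fin D → Carrier) α →
                      LeftKernel R α → (∀ j → X j ≈ sum (λ t → R j t * w t)) → sum (λ j → α j * X j) ≈ 0#
  left-kernel-kills {D} {K} R w X α αR≈0 X≈Rw = begin
    sum (λ j → α j * X j)                          ≈⟨ sum-cong-≋ {D} (λ j → *-congˡ (X≈Rw j)) ⟩
    sum (λ j → α j * sum (λ t → R j t * w t))      ≈⟨ sum-assoc α R w ⟩
    sum (λ t → sum (λ j → α j * R j t) * w t)      ≈⟨ sum-zero {K} (λ t → trans (*-congʳ (αR≈0 t)) (zeroˡ _)) ⟩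
    0#                                             ∎

  unit : ∀ {D} → Fin D → Fin D → Carrier
  unit j k = if does (k ≟ᶠ j) then 1# else 0#

  lincomb-unit : ∀ {a} {A : Set a} {D} (u : Fin D → Vect A) j x → lincomb (unit j) u x ≈ u j x
  lincomb-unit u j x = begin
    lincomb (unit j) u x               ≈⟨ lincomb≈sum (unit j) u x ⟩
    sum (λ k → unit j k * u k x)       ≈⟨ sum-single _ j off-diagonal ⟩
    unit j j * u j x                   ≈⟨ *-congʳ (reflexive diagonal) ⟩
    1# * u j x                         ≈⟨ *-identityˡ _ ⟩
    u j x                              ∎
    where
      off-diagonal : ∀ k → k ≢ j → unit j k * u k x ≈ 0#
      off-diagonal k k≢j with k ≟ᶠ j
      ... | yes k≡j = ⊥-elim (k≢j k≡j)
      ... | no _    = zeroˡ _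
      diagonal : unit j j ≡ 1#
      diagonal with j ≟ᶠ j
      ... | yes _   = ≡.refl
      ... | no j≢j  = ⊥-elim (j≢j ≡.refl)

  module _ {a} {A : Set a} where

    InSpan : ∀ {d} → (Fin d → Vect A) → Vect A → Set (a ⊔ c ⊔ ℓ)
    InSpan {d} ws x = ∃[ cs ] (x ≋ lincomb {d = d} cs ws)

    lincomb-closed : ∀ {p} {Q : Pred (Vect A) p} → IsSubspace Q →
                     ∀ {d} (cs : Fin d → Carrier) (vs : Fin d → Vect A) → (∀ k → Q (vs k)) → Q (lincomb cs vs)
    lincomb-closed Q-sub {zero}  cs vs vs∈Q = IsSubspace.has-0 Q-sub
    lincomb-closed Q-sub {suc d} cs vs vs∈Q =
      IsSubspace.+-closed Q-sub (IsSubspace.·-closed Q-sub (cs zero) (vs∈Q zero))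
                                (lincomb-closed Q-sub (cs ∘ suc) (vs ∘ suc) (vs∈Q ∘ suc))

    span-blocks : ∀ {k} (act : Fin k → Bool) (d : Fin k → ℕ)
                  (ws : (i : Fin k) → T (act i) → Fin (d i) → Vect A)
                  (y : (i : Fin k) → T (act i) → Vect A) (x : Vect A) →
                  (∀ i p → InSpan (ws i p) (y i p)) →
                  (∀ a → x a ≈ sum (λ i → when (act i) (λ p → y i p a))) →
                  InSpan (blocks act d ws) x
    span-blocks {k} act d ws y x y∈span x≈ = cs , λ a → begin
      x a
        ≈⟨ x≈ a ⟩
      sum (λ i → when (act i) (λ p → y i p a))
        ≈⟨ sum-cong-≋ {k} (λ i → when-cong (act i) (λ p →
             trans (proj₂ (y∈span i p) a) (lincomb≈sum (coeffs i p) (ws i p) a))) ⟩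
      sum (λ i → when (act i) (λ p → sum (λ t → coeffs i p t * ws i p t a)))
        ≈⟨ sum-cong-≋ {k} (λ i → when-cong (act i) (λ p → sum-cong-≋ {d i} (λ t → reflexive
             (≡.cong₂ (λ u v → u * v a) (≡.sym (blocks-blockPos act d coeffs i p t))
                                          (≡.sym (blocks-blockPos act d ws i p t)))))) ⟩
      sum (λ i → when (act i) (λ p → sum (λ t → cs (blockPos act d i p t) * W (blockPos act d i p t) a)))
        ≈⟨ sum-blocks act d (λ col → cs col * W col a) ⟨
      sum (λ col → cs col * W col a)
        ≈⟨ lincomb≈sum cs W a ⟨
      lincomb cs W a ∎
      where
        coeffs : (i : Fin k) → T (act i) → Fin (d i) → Carrier
        coeffs i p = proj₁ (y∈span i p)
        cs : Fin (sumℕ k (selected act d)) → Carrier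
        cs = blocks act d coeffs
        W : Fin (sumℕ k (selected act d)) → Vect A
        W = blocks act d ws

  -- Let bs be a basis of the shortened code C_J; each bs t is the restriction of a
  -- codeword lift t vanishing outside J.  Every codeword vanishing outside J is a
  -- combination of these lifts.
  shortened-span : ∀ {n p} (C : Pred (Vect (Fin n)) p) (J : Subset n) {d} (bs : Fin d → Vect (Σ (Fin n) (_∈ J))) →
                   (basis : IsBasis (Short C J) bs) → ∀ x → C x → (∀ i → i ∉ J → x i ≈ 0#) →
                   InSpan (λ t → proj₁ (proj₁ basis t)) x
  shortened-span {n} C J {d} bs (bs∈C_J , _ , spanning) x x∈C x≈0 = cs , x≈comb
    where
      lift : Fin d → Vect (Fin n)
      lift t = proj₁ (bs∈C_J t)
      coords : InSpan bs (λ j → x (proj₁ j))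
      coords = spanning (λ j → x (proj₁ j)) (x , x∈C , x≈0 , λ j → refl)
      cs : Fin d → Carrier
      cs = proj₁ coords
      x≈comb : ∀ i → x i ≈ lincomb cs lift i
      x≈comb i with i ∈? J
      ... | yes i∈J = begin
        x i                                  ≈⟨ proj₂ coords (i , i∈J) ⟩
        lincomb cs bs (i , i∈J)              ≈⟨ lincomb≈sum cs bs (i , i∈J) ⟩
        sum (λ t → cs t * bs t (i , i∈J))    ≈⟨ sum-cong-≋ {d} (λ t → *-congˡ (sym (proj₂ (proj₂ (proj₂ (bs∈C_J t))) (i , i∈J)))) ⟩
        sum (λ t → cs t * lift t i)          ≈⟨ lincomb≈sum cs lift i ⟨
        lincomb cs lift i                    ∎
      ... | no i∉J = begin
        x i                                  ≈⟨ x≈0 i i∉J ⟩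
        0#                                   ≈⟨ sum-zero {d} (λ t → trans (*-congˡ (proj₁ (proj₂ (proj₂ (bs∈C_J t))) i i∉J)) (zeroʳ _)) ⟨
        sum (λ t → cs t * lift t i)          ≈⟨ lincomb≈sum cs lift i ⟨
        lincomb cs lift i                    ∎

  -- The rank bound, proved by Gaussian elimination on the columns of M.  Deciding
  -- whether a field element is zero is the only non-constructive ingredient, so it
  -- is taken as a parameter.
  module RankBound (_≈0? : ∀ x → Dec (x ≈ 0#)) {a} {A : Set a} where

    -- If every combination of u whose coefficient vector lies in the left kernel of
    -- the D × K₁ matrix M lies in the span of K₂ vectors ws, then an independent
    -- family u has at most K₁ + K₂ members (dim ker ≥ D − K₁, and it embeds in span ws).
    Bound : ℕ → ℕ → Set (a ⊔ c ⊔ ℓ)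
    Bound K₂ K₁ = ∀ {D} (u : Fin D → Vect A) (M : Fin D → Fin K₁ → Carrier) (ws : Fin K₂ → Vect A) →
                  LinIndep u → (∀ α → LeftKernel M α → InSpan ws (lincomb α u)) → D ≤ℕ K₁ +ℕ K₂

    -- With no columns and no ws, every combination of u vanishes, so u is empty.
    bound-0-0 : Bound 0 0
    bound-0-0 {zero}  u M ws indep comb∈span = z≤n
    bound-0-0 {suc D} u M ws indep comb∈span =
      ⊥-elim (0≉1 (sym (indep (λ _ → 1#) (proj₂ (comb∈span (λ _ → 1#) (λ ()))) zero)))

    -- With no columns, the coordinates of the u j in terms of ws form a matrix whose
    -- left kernel yields vanishing combinations: trade the ws for columns.
    ws-to-columns : ∀ {K} → Bound 0 K → Bound K 0
    ws-to-columns {K} bound {D} u M ws indep comb∈span =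
      ≡.subst (D ≤ℕ_) (ℕP.+-identityʳ K) (bound u Coord (λ ()) indep vanishing)
      where
        Coord : Fin D → Fin K → Carrier
        Coord j = proj₁ (comb∈span (unit j) (λ ()))
        u≈Coord·ws : ∀ x j → u j x ≈ sum (λ t → Coord j t * ws t x)
        u≈Coord·ws x j = trans (sym (lincomb-unit u j x))
                          (trans (proj₂ (comb∈span (unit j) (λ ())) x) (lincomb≈sum (Coord j) ws x))
        vanishing : ∀ α → LeftKernel Coord α → InSpan (λ ()) (lincomb α u)
        vanishing α αCoord≈0 = (λ ()) , λ x →
          trans (lincomb≈sum α u x) (left-kernel-kills Coord (λ t → ws t x) (λ j → u j x) α αCoord≈0 (u≈Coord·ws x))

    -- A zero column imposes no condition on the coefficients.
    drop-zero-column : ∀ {K₂ K₁} → Bound K₂ K₁ → ∀ {D} (u : Fin D → Vect A) M (ws : Fin K₂ → Vect A) →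
                       (∀ j → M j zero ≈ 0#) → LinIndep u →
                       (∀ α → LeftKernel {K = suc K₁} M α → InSpan ws (lincomb α u)) → D ≤ℕ suc K₁ +ℕ K₂
    drop-zero-column bound {D} u M ws column≈0 indep comb∈span =
      ℕP.≤-trans (bound u (λ j m → M j (suc m)) ws indep (λ α αM′≈0 → comb∈span α (kernel α αM′≈0)))
                 (ℕP.n≤1+n _)
      where
        kernel : ∀ α → LeftKernel (λ j m → M j (suc m)) α → LeftKernel M α
        kernel α αM′≈0 zero    = sum-zero {D} (λ j → trans (*-congˡ (column≈0 j)) (zeroʳ _))
        kernel α αM′≈0 (suc m) = αM′≈0 m

    -- Elimination with pivot entry M j₀ 0 ≉ 0: subtract multiples of row j₀ from the
    -- other rows so that column 0 vanishes outside row j₀.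
    module Pivot {D K₁} (M : Fin (suc D) → Fin (suc K₁) → Carrier) (j₀ : Fin (suc D)) (pivot≉0 : ¬ (M j₀ zero ≈ 0#)) where

      pivot⁻¹ : Carrier
      pivot⁻¹ = proj₁ (inverse _ pivot≉0)

      ratio : Fin D → Carrier
      ratio j = M (punchIn j₀ j) zero * pivot⁻¹

      reduce : (Fin (suc D) → Carrier) → Fin D → Carrier
      reduce X j = X (punchIn j₀ j) - ratio j * X j₀

      extend : (Fin D → Carrier) → Fin (suc D) → Carrier
      extend α = insertAt α j₀ (- sum (λ j → α j * ratio j))

      extend-reduce : ∀ α X → sum (λ k → extend α k * X k) ≈ sum (λ j → α j * reduce X j)
      extend-reduce α X = begin
        sum (λ k → extend α k * X k)
          ≈⟨ sum-remove {i = j₀} (λ k → extend α k * X k) ⟩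
        extend α j₀ * X j₀ + sum (λ j → extend α (punchIn j₀ j) * X (punchIn j₀ j))
          ≈⟨ +-cong (*-congʳ (reflexive (insertAt-lookup α j₀ _)))
                    (sum-cong-≋ {D} (λ j → *-congʳ (reflexive (insertAt-punchIn α j₀ _ j)))) ⟩
        - S * X j₀ + sum (λ j → α j * X (punchIn j₀ j))
          ≈⟨ +-comm _ _ ⟩
        sum (λ j → α j * X (punchIn j₀ j)) + - S * X j₀
          ≈⟨ +-congˡ (trans (sym (-‿distribˡ-* S (X j₀))) (-‿distribʳ-* S (X j₀))) ⟩
        sum (λ j → α j * X (punchIn j₀ j)) + S * - X j₀
          ≈⟨ +-congˡ (*-distribʳ-sum (- X j₀) (λ j → α j * ratio j)) ⟩
        sum (λ j → α j * X (punchIn j₀ j)) + sum (λ j → (α j * ratio j) * - X j₀)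
          ≈⟨ ∑-distrib-+ (λ j → α j * X (punchIn j₀ j)) (λ j → (α j * ratio j) * - X j₀) ⟨
        sum (λ j → α j * X (punchIn j₀ j) + (α j * ratio j) * - X j₀)
          ≈⟨ sum-cong-≋ {D} (λ j → termwise (α j) (X (punchIn j₀ j)) (ratio j) (X j₀)) ⟩
        sum (λ j → α j * reduce X j) ∎
        where
          S : Carrier
          S = sum (λ j → α j * ratio j)
          termwise : ∀ a x r y → a * x + (a * r) * - y ≈ a * (x - r * y)
          termwise a x r y = begin
            a * x + (a * r) * - y     ≈⟨ +-congˡ (-‿distribʳ-* (a * r) y) ⟨
            a * x + - ((a * r) * y)   ≈⟨ +-congˡ (-‿cong (*-assoc a r y)) ⟩
            a * x + - (a * (r * y))   ≈⟨ +-congˡ (-‿distribʳ-* a (r * y)) ⟩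
            a * x + a * - (r * y)     ≈⟨ distribˡ a x (- (r * y)) ⟨
            a * (x - r * y)           ∎

      reduce-column₀ : ∀ j → reduce (λ k → M k zero) j ≈ 0#
      reduce-column₀ j = begin
        m - (m * pivot⁻¹) * M j₀ zero   ≈⟨ +-congˡ (-‿cong (*-assoc m pivot⁻¹ (M j₀ zero))) ⟩
        m - m * (pivot⁻¹ * M j₀ zero)   ≈⟨ +-congˡ (-‿cong (*-congˡ (trans (*-comm _ _) (proj₂ (inverse _ pivot≉0))))) ⟩
        m - m * 1#                      ≈⟨ +-congˡ (-‿cong (*-identityʳ m)) ⟩
        m - m                           ≈⟨ -‿inverseʳ m ⟩
        0#                              ∎
        where
          m : Carrier
          m = M (punchIn j₀ j) zero

    eliminate-pivot : ∀ {K₂ K₁} → Bound K₂ K₁ → ∀ {D} (u : Fin (suc D) → Vect A) M (ws : Fin K₂ → Vect A)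
                      (j₀ : Fin (suc D)) → ¬ (M j₀ zero ≈ 0#) → LinIndep u →
                      (∀ α → LeftKernel {K = suc K₁} M α → InSpan ws (lincomb α u)) → suc D ≤ℕ suc K₁ +ℕ K₂
    eliminate-pivot bound {D} u M ws j₀ pivot≉0 indep comb∈span =
      s≤s (bound u′ (λ j m → reduce (λ k → M k (suc m)) j) ws indep′ comb′∈span)
      where
        open Pivot M j₀ pivot≉0
        u′ : Fin D → Vect A
        u′ j x = reduce (λ k → u k x) j
        lincomb-extend : ∀ α x → lincomb (extend α) u x ≈ lincomb α u′ x
        lincomb-extend α x = begin
          lincomb (extend α) u x               ≈⟨ lincomb≈sum (extend α) u x ⟩
          sum (λ k → extend α k * u k x)       ≈⟨ extend-reduce α (λ k → u k x) ⟩
          sum (λ j → α j * u′ j x)             ≈⟨ lincomb≈sum α u′ x ⟨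
          lincomb α u′ x                       ∎
        indep′ : LinIndep u′
        indep′ α comb≈0 j =
          trans (reflexive (≡.sym (insertAt-punchIn α j₀ _ j)))
                (indep (extend α) (λ x → trans (lincomb-extend α x) (comb≈0 x)) (punchIn j₀ j))
        kernel : ∀ α → LeftKernel (λ j m → reduce (λ k → M k (suc m)) j) α → LeftKernel M (extend α)
        kernel α αM′≈0 zero    = trans (extend-reduce α (λ k → M k zero))
                                       (sum-zero {D} (λ j → trans (*-congˡ (reduce-column₀ j)) (zeroʳ _)))
        kernel α αM′≈0 (suc m) = trans (extend-reduce α (λ k → M k (suc m))) (αM′≈0 m)
        comb′∈span : ∀ α → LeftKernel (λ j m → reduce (λ k → M k (suc m)) j) α → InSpan ws (lincomb α u′)
        comb′∈span α αM′≈0 with comb∈span (extend α) (kernel α αM′≈0)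
        ... | cs , comb≈ = cs , λ x → trans (sym (lincomb-extend α x)) (comb≈ x)

    add-column : ∀ {K₂ K₁} → Bound K₂ K₁ → Bound K₂ (suc K₁)
    add-column bound {zero}  u M ws indep comb∈span = z≤n
    add-column bound {suc D} u M ws indep comb∈span with FinP.all? (λ j → M j zero ≈0?)
    ... | yes column≈0 = drop-zero-column bound u M ws column≈0 indep comb∈span
    ... | no  column≉0 with FinP.¬∀⟶∃¬ (suc D) _ (λ j → M j zero ≈0?) column≉0
    ...   | j₀ , pivot≉0 = eliminate-pivot bound u M ws j₀ pivot≉0 indep comb∈span

    rank-bound : ∀ K₂ K₁ → Bound K₂ K₁
    rank-bound K₂ zero     = ws-to-columns (no-ws K₂)
      where
        no-ws : ∀ K → Bound 0 K
        no-ws zero    = bound-0-0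
        no-ws (suc K) = add-column (no-ws K)
    rank-bound K₂ (suc K₁) = add-column (rank-bound K₂ K₁)

  ¬¬-≈0-decidable : ¬ ¬ (∀ x → Dec (x ≈ 0#))
  ¬¬-≈0-decidable = ¬¬-map decide (¬¬-decidable-Fin size {λ k → enum k ≈ 0#})
    where
      decide : (∀ k → Dec (enum k ≈ 0#)) → ∀ x → Dec (x ≈ 0#)
      decide enum≈0? x with enum-surj x
      ... | k , enum-k≈x with enum≈0? k
      ...   | yes enum-k≈0 = yes (trans (sym enum-k≈x) enum-k≈0)
      ...   | no  enum-k≉0 = no (λ x≈0 → enum-k≉0 (trans enum-k≈x x≈0))

does⇒ : ∀ {p} {P : Set p} (P? : Dec P) → T (does P?) → P
does⇒ (yes p) _ = p

⇒does : ∀ {p} {P : Set p} (P? : Dec P) → P → T (does P?)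
⇒does (yes _) _ = _
⇒does (no ¬p) p = ¬p p

incident-end : ∀ (G : Graph) e v → T (incB G e v) → proj₁ (ends G e) ≡ v ⊎ proj₂ (ends G e) ≡ v
incident-end G e v inc = Sum.map (does⇒ (_ ≟ᶠ v)) (does⇒ (_ ≟ᶠ v)) (Equivalence.to T-∨ inc)

-- If a configuration of the full
-- behavior vanishes at every vertex of the centre V₀, then its restriction to any
-- branch is again in the full behavior, and the symbols split over the branches.

module Cutting {c ℓ} (F : FiniteField c ℓ) where
  open FiniteField F hiding (zero)
  open LinAlg F
  open Models F
  open LinearAlgebra F
  open import Algebra.Properties.Semiring.Sum semiring using (sum)
  open import Relation.Binary.Reasoning.Setoid setoid

  keep : ∀ {p} {P : Set p} → Dec P → Carrier → Carrier
  keep (yes _) x = x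
  keep (no _)  x = 0#

  keep-yes : ∀ {p} {P : Set p} (P? : Dec P) {x} → P → keep P? x ≈ x
  keep-yes (yes _) p = refl
  keep-yes (no ¬p) p = ⊥-elim (¬p p)

  keep-≈0 : ∀ {p} {P : Set p} (P? : Dec P) {x} → (P → x ≈ 0#) → keep P? x ≈ 0#
  keep-≈0 (yes p) x≈0 = x≈0 p
  keep-≈0 (no _)  x≈0 = refl

  module _ {n} {G : Graph} {ω : Fin n → Fin (nV G)} (Γ : GraphicalModel n G ω) where

    Config : Set c
    Config = Vect (GIdx G ω (sdim Γ))

    at : ∀ v → LocIdx G ω (sdim Γ) v → GIdx G ω (sdim Γ)
    at = loc G ω (sdim Γ)

    VanishesOn : Pred (Fin (nV G)) 0ℓ → Config → Set ℓ
    VanishesOn V₀ b = ∀ v → V₀ v → ∀ l → b (at v l) ≈ 0#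

    restrict : (W : Pred (Fin (nV G)) 0ℓ) → (∀ v → Dec (W v)) → Config → Config
    restrict W W? b (inj₁ i)       = keep (W? (ω i)) (b (inj₁ i))
    restrict W W? b (inj₂ (e , t)) = keep (W? (proj₁ (ends G e)) ⊎-dec W? (proj₂ (ends G e))) (b (inj₂ (e , t)))

    restrict-inside : ∀ W W? b v → W v → ∀ l → restrict W W? b (at v l) ≈ b (at v l)
    restrict-inside W W? b v v∈W (inj₁ (i , ωi≡v)) =
      keep-yes (W? (ω i)) (≡.subst W (≡.sym (does⇒ (ω i ≟ᶠ v) ωi≡v)) v∈W)
    restrict-inside W W? b v v∈W (inj₂ ((e , inc) , t)) with incident-end G e v inc
    ... | inj₁ end₁≡v = keep-yes (W? _ ⊎-dec W? _) (inj₁ (≡.subst W (≡.sym end₁≡v) v∈W))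
    ... | inj₂ end₂≡v = keep-yes (W? _ ⊎-dec W? _) (inj₂ (≡.subst W (≡.sym end₂≡v) v∈W))

    module _ {K : Set} {V₀ : Pred (Fin (nV G)) 0ℓ} {Vs : K → Pred (Fin (nV G)) 0ℓ}
             (star : IsStarPartition G V₀ Vs) (Vs? : ∀ k v → Dec (Vs k v))
             (b : Config) (b-vanishes : VanishesOn V₀ b) where

      -- Outside a branch, everything kept is the state of an edge leaving the branch;
      -- its outer end lies in the centre V₀, where b vanishes.
      restrict-outside : ∀ k v → ¬ Vs k v → ∀ l → restrict (Vs k) (Vs? k) b (at v l) ≈ 0#
      restrict-outside k v v∉Vk (inj₁ (i , ωi≡v)) =
        keep-≈0 (Vs? k (ω i)) (λ ωi∈Vk → ⊥-elim (v∉Vk (≡.subst (Vs k) (does⇒ (ω i ≟ᶠ v) ωi≡v) ωi∈Vk)))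
      restrict-outside k v v∉Vk (inj₂ ((e , inc) , t)) =
        keep-≈0 (Vs? k _ ⊎-dec Vs? k _) kept⇒0
        where
          across : ∀ w → Vs k w → Adjacent G w v → b (at v (inj₂ ((e , inc) , t))) ≈ 0#
          across w w∈Vk w~v with IsStarPartition.nbhd star k v (w , w∈Vk , w~v)
          ... | inj₁ v∈Vk = ⊥-elim (v∉Vk v∈Vk)
          ... | inj₂ v∈V₀ = b-vanishes v v∈V₀ (inj₂ ((e , inc) , t))
          kept⇒0 : Vs k (proj₁ (ends G e)) ⊎ Vs k (proj₂ (ends G e)) → b (inj₂ (e , t)) ≈ 0#
          kept⇒0 kept with kept | incident-end G e v inc
          ... | inj₁ end₁∈Vk | inj₁ end₁≡v = ⊥-elim (v∉Vk (≡.subst (Vs k) end₁≡v end₁∈Vk))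
          ... | inj₁ end₁∈Vk | inj₂ end₂≡v = across _ end₁∈Vk (e , inj₁ (≡.cong (proj₁ (ends G e) ,_) end₂≡v))
          ... | inj₂ end₂∈Vk | inj₂ end₂≡v = ⊥-elim (v∉Vk (≡.subst (Vs k) end₂≡v end₂∈Vk))
          ... | inj₂ end₂∈Vk | inj₁ end₁≡v = across _ end₂∈Vk (e , inj₂ (≡.cong (_, proj₂ (ends G e)) end₁≡v))

      restrict-behavior : Behavior Γ b → ∀ k → Behavior Γ (restrict (Vs k) (Vs? k) b)
      restrict-behavior b∈𝔅 k v with Vs? k v
      ... | yes v∈Vk = IsSubspace.resp (Cv-sub Γ v) (λ l → sym (restrict-inside (Vs k) (Vs? k) b v v∈Vk l)) (b∈𝔅 v)
      ... | no  v∉Vk = IsSubspace.resp (Cv-sub Γ v) (λ l → sym (restrict-outside k v v∉Vk l)) (IsSubspace.has-0 (Cv-sub Γ v))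

    symbols-split : ∀ {k} (act : Fin k → Bool) {V₀ : Pred (Fin (nV G)) 0ℓ} (W : Fin k → Pred (Fin (nV G)) 0ℓ)
                    (W? : ∀ e v → Dec (W e v)) →
                    IsStarPartition G V₀ (λ (e : Σ (Fin k) (T ∘ act)) → W (proj₁ e)) →
                    ∀ b → VanishesOn V₀ b →
                    ∀ i → b (inj₁ i) ≈ sum (λ e → when (act e) (λ _ → restrict (W e) (W? e) b (inj₁ i)))
    symbols-split {k} act W W? star b b-vanishes i with IsStarPartition.cover star (ω i)
    ... | inj₁ ωi∈V₀ =
      trans b-i≈0 (sym (sum-zero {k} (λ e → when-zero (act e) _ (λ _ → keep-≈0 (W? e (ω i)) (λ _ → b-i≈0)))))
      where
        b-i≈0 : b (inj₁ i) ≈ 0#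
        b-i≈0 = b-vanishes (ω i) ωi∈V₀ (inj₁ (i , ⇒does (ω i ≟ᶠ ω i) ≡.refl))
    ... | inj₂ ((e₀ , e₀-active) , ωi∈We₀) = sym (begin
      sum (λ e → when (act e) (λ _ → restrict (W e) (W? e) b (inj₁ i)))
        ≈⟨ sum-single _ e₀ other-branches ⟩
      when (act e₀) (λ _ → restrict (W e₀) (W? e₀) b (inj₁ i))
        ≈⟨ when-true (act e₀) _ e₀-active ⟩
      keep (W? e₀ (ω i)) (b (inj₁ i))
        ≈⟨ keep-yes (W? e₀ (ω i)) ωi∈We₀ ⟩
      b (inj₁ i) ∎)
      where
        other-branches : ∀ e → e ≢ e₀ → when (act e) (λ _ → restrict (W e) (W? e) b (inj₁ i)) ≈ 0#
        other-branches e e≢e₀ = when-zero (act e) _ λ e-active → keep-≈0 (W? e (ω i)) λ ωi∈We →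
          ⊥-elim (IsStarPartition.disj star (e , e-active) (e₀ , e₀-active) (ω i)
                                            (λ eq → e≢e₀ (≡.cong proj₁ eq)) ωi∈We ωi∈We₀)

-- Lift a basis u of C to configurations B j of the
-- full behavior; the coordinates of the B j at the vertices of V₀ form a matrix M.
-- A combination of the B j with coefficients in the left kernel of M vanishes on V₀,
-- so it splits into branch configurations whose symbols lie in the shortened codes;
-- the rank bound then gives the inequality.

module StarBound {c ℓ} (F : FiniteField c ℓ) where
  open FiniteField F hiding (zero)
  open LinAlg F
  open Models F
  open LinearAlgebra F
  open Cutting F
  open import Algebra.Properties.Semiring.Sum semiring using (sum; sum-cong-≋)
  open import Relation.Binary.Reasoning.Setoid setoid

  module _ (_≈0? : ∀ x → Dec (x ≈ 0#))
           {n} (C : Pred (Vect (Fin n)) (c ⊔ ℓ)) {G : Graph} {ω : Fin n → Fin (nV G)}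
           (Γ : GraphicalModel n G ω) (realizes : Realizes Γ C)
           {dimC : ℕ} (C-basis : HasDim C dimC)
           {dimCv : Fin (nV G) → ℕ} (Cv-basis : ∀ v → HasDim (Cv Γ v) (dimCv v))
           (V₀ : Subset (nV G)) {k} (act : Fin k → Bool)
           (W : Fin k → Pred (Fin (nV G)) 0ℓ) (W? : ∀ e v → Dec (W e v))
           (star : IsStarPartition G (_∈ V₀) (λ (e : Σ (Fin k) (T ∘ act)) → W (proj₁ e)))
           (J : Fin k → Subset n) (W⇒J : ∀ e → T (act e) → ∀ i → W e (ω i) → i ∈ J e)
           {dimJ : Fin k → ℕ} (J-basis : ∀ e → T (act e) → HasDim (Short C (J e)) (dimJ e)) where

    u : Fin dimC → Vect (Fin n)
    u = proj₁ C-basis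

    lift : ∀ j → ∃[ b ] (Behavior Γ b × (λ i → b (inj₁ i)) ≋ u j)
    lift j = proj₁ (realizes (u j)) (proj₁ (proj₂ C-basis) j)

    B : Fin dimC → Config Γ
    B j = proj₁ (lift j)

    local-coords : ∀ j v → ∃[ cs ] ((λ l → B j (at Γ v l)) ≋ lincomb cs (proj₁ (Cv-basis v)))
    local-coords j v = proj₂ (proj₂ (proj₂ (Cv-basis v))) _ (proj₁ (proj₂ (lift j)) v)

    M : Fin dimC → Fin (sumℕ (nV G) (selected (lookup V₀) dimCv)) → Carrier
    M j = blocks (lookup V₀) dimCv (λ v _ → proj₁ (local-coords j v))

    short-lifts : ∀ e → T (act e) → Fin (dimJ e) → Vect (Fin n)
    short-lifts e p t = proj₁ (proj₁ (proj₂ (J-basis e p)) t)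

    ws : Fin (sumℕ k (selected act dimJ)) → Vect (Fin n)
    ws = blocks act dimJ short-lifts

    module _ (α : Fin dimC → Carrier) (αM≈0 : LeftKernel M α) where

      b : Config Γ
      b = lincomb α B

      b∈𝔅 : Behavior Γ b
      b∈𝔅 v = lincomb-closed (Cv-sub Γ v) α (λ j l → B j (at Γ v l)) (λ j → proj₁ (proj₂ (lift j)) v)

      b-vanishes : VanishesOn Γ (_∈ V₀) b
      b-vanishes v v∈V₀ l = trans (lincomb≈sum α B (at Γ v l))
        (left-kernel-kills (λ j → proj₁ (local-coords j v)) (λ t → proj₁ (Cv-basis v) t l)
                           (λ j → B j (at Γ v l)) α block-kernel
                           (λ j → trans (proj₂ (local-coords j v) l) (lincomb≈sum (proj₁ (local-coords j v)) (proj₁ (Cv-basis v)) l)))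
        where
          in-V₀ : T (lookup V₀ v)
          in-V₀ = ≡.subst T (≡.sym ([]=⇒lookup v∈V₀)) _
          block-kernel : LeftKernel (λ j → proj₁ (local-coords j v)) α
          block-kernel t = trans (sum-cong-≋ {dimC} (λ j → *-congˡ (reflexive (≡.sym
                             (blocks-blockPos (lookup V₀) dimCv (λ v _ → proj₁ (local-coords j v)) v in-V₀ t)))))
                           (αM≈0 (blockPos (lookup V₀) dimCv v in-V₀ t))

      branch : Fin k → Vect (Fin n)
      branch e i = restrict Γ (W e) (W? e) b (inj₁ i)

      branch-in-span : ∀ e (p : T (act e)) → InSpan (short-lifts e p) (branch e)
      branch-in-span e p = shortened-span C (J e) _ (proj₂ (J-basis e p)) (branch e) branch∈C outside-J
        where
          branch∈C : C (branch e)
          branch∈C = proj₂ (realizes (branch e))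
            (restrict Γ (W e) (W? e) b , restrict-behavior Γ star (λ e′ → W? (proj₁ e′)) b b-vanishes b∈𝔅 (e , p) , λ i → refl)
          outside-J : ∀ i → i ∉ J e → branch e i ≈ 0#
          outside-J i i∉J = keep-≈0 (W? e (ω i)) (λ ωi∈We → ⊥-elim (i∉J (W⇒J e p i ωi∈We)))

      comb∈span : InSpan ws (lincomb α u)
      comb∈span = span-blocks act dimJ short-lifts (λ e _ → branch e) (lincomb α u) branch-in-span
        (λ i → trans (lincomb-cong α {u} {B} {i} {inj₁ i} (λ j → sym (proj₂ (proj₂ (lift j)) i)))
                     (symbols-split Γ act W W? star b b-vanishes i))

    star-bound : dimC ≤ℕ sumℕ (nV G) (selected (lookup V₀) dimCv) +ℕ sumℕ k (selected act dimJ)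
    star-bound = RankBound.rank-bound _≈0? _ _ u M ws (proj₁ (proj₂ (proj₂ C-basis))) comb∈span

bag-bound : ∀ G T′ (β : Fin (nV T′) → Subset (nV G)) (dimCv : Fin (nV G) → ℕ) z →
            sumℕ (nV G) (selected (lookup (β z)) dimCv) ≤ℕ maxℕ (nV G) dimCv *ℕ vcWidth G T′ β
bag-bound G T′ β dimCv z = begin
  sumℕ (nV G) (selected (lookup (β z)) dimCv)  ≤⟨ sum-over-subset (nV G) (β z) dimCv κ (≤-maxℕ (nV G) dimCv) ⟩
  ∣ β z ∣ *ℕ κ                                 ≤⟨ ℕP.*-monoˡ-≤ κ (≤-maxℕ (nV T′) (λ x → ∣ β x ∣) z) ⟩
  vcWidth G T′ β *ℕ κ                          ≡⟨ ℕP.*-comm (vcWidth G T′ β) κ ⟩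
  κ *ℕ vcWidth G T′ β                          ∎
  where
    open ℕP.≤-Reasoning
    κ : ℕ
    κ = maxℕ (nV G) dimCv

-- The star
-- bound uses two decisions that are only ¬¬-available; the goal is a decidable
-- integer inequality, hence ¬¬-stable.

open import Data.Nat using (_*_)
open import Data.Integer using (_≤_)
open import Function.Bundles using (_⇔_)

proposition6p1 : ∀ {c ℓ} (𝔽 : FiniteField c ℓ) →
    let open LinAlg 𝔽 in let open Models 𝔽 in
    (n : ℕ) (C : Pred (Vect (Fin n)) (c ⊔ ℓ)) → IsSubspace C →
    (G : Graph) → Connected G → (ω : Fin n → Fin (nV G)) →
    (T′ : Graph) (β : Fin (nV T′) → Subset (nV G)) → IsVertexCutTree G T′ β →
    (Γ : GraphicalModel n G ω) → InRealizations C Γ →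
    (dimC : ℕ) → HasDim C dimC →
    (dimCv : Fin (nV G) → ℕ) → (∀ v → HasDim (Cv Γ v) (dimCv v)) →
    (J : Fin (nV T′) → Fin (nE T′) → Subset n) →
    (∀ z e → T (incB T′ e z) → ∀ i → (i ∈ J z e) ⇔ Vcomp G T′ β z e (ω i)) →
    (dimJ : Fin (nV T′) → Fin (nE T′) → ℕ) →
    (∀ z e → T (incB T′ e z) → HasDim (Short C (J z e)) (dimJ z e)) →
    μ T′ dimC dimJ ≤ + (κ dimCv * vcWidth G T′ β)
proposition6p1 𝔽 n C _ G _ ω T′ β vct Γ (_ , realizes) dimC C-basis dimCv Cv-basis J J⇔W dimJ J-basis =
  maxℤ-lub (nV T′) _ _ (ℤ.+≤+ z≤n) m≤κ·width
  where
    open FiniteField 𝔽 using (_≈_; 0#)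
    open Models 𝔽 using (mval; κ)

    m≤κ·width-given : ∀ z → (∀ x → Dec (x ≈ 0#)) → (∀ e v → Dec (Vcomp G T′ β z e v)) →
                      mval T′ dimC dimJ z ≤ + (κ dimCv * vcWidth G T′ β)
    m≤κ·width-given z _≈0? W? = minus-≤ dimC _ _ _
      (StarBound.star-bound 𝔽 _≈0? C Γ realizes C-basis Cv-basis (β z) (λ e → incB T′ e z)
                            (Vcomp G T′ β z) W? (IsVertexCutTree.VC3 vct z)
                            (J z) (λ e p i → Equivalence.from (J⇔W z e p i)) (J-basis z))
      (bag-bound G T′ β dimCv z)

    m≤κ·width : ∀ z → mval T′ dimC dimJ z ≤ + (κ dimCv * vcWidth G T′ β)
    m≤κ·width z = decidable-stable (_ ℤP.≤? _) λ m≰κ·width →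
      LinearAlgebra.¬¬-≈0-decidable 𝔽 λ ≈0? →
      ¬¬-∀-Fin (nE T′) (λ e → ¬¬-decidable-Fin (nV G)) λ W? →
      m≰κ·width (m≤κ·width-given z ≈0? W?)
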